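{- If $D\in\mathcal{F}$, then for every $v_{ab}\in H_{ab}$ there are arcs $a\to v_{ab}$ and $b\to v_{ab}$.
   Context: An oriented graph is a loopless directed graph with no pair of opposite arcs. Strong diameter $2$: for every ordered pair of distinct vertices $(i,j)$ there is a directed path from $i$ to $j$ of length at most $2$. 2-connected: strong connectivity at least $2$. Paths are simple directed paths; internal vertices are those other than the endpoints. $\mathcal{F}$ is the set of 2-connected oriented graphs $D$ with strong diameter $2$ having six distinct vertices $p,q,a,b,c,r$ such that: arcs $p\to c$, $q\to c$, $q\to b$, $b\to r$, $a\to r$, $p\to a$ are present; every directed path from $p$ to $r$ contains $a$ or contains both $c$ and $b$; every directed path from $q$ to $r$ contains $b$ or contains both $c$ and $a$; every directed path from $c$ to $r$ contains $a$ or $b$. $H_{ab}$ is the set of internal vertices of directed paths from $a$ to $r$ not containing $b$, or from $b$ to $r$ not containing $a$. -}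

module Defs where

open import Data.Nat using (ℕ; zero; suc; _≤_)
open import Data.Fin using (Fin)
open import Data.Bool using (Bool; T)
open import Data.List using (List; []; _∷_)
open import Data.List.Membership.Propositional using (_∈_)
open import Data.List.Relation.Unary.Unique.Propositional using (Unique)
open import Data.Product using (_×_; Σ; ∃; ∃-syntax)
open import Data.Sum using (_⊎_)
open import Relation.Nullary using (¬_)
open import Relation.Binary.PropositionalEquality using (_≡_; _≢_)

Digraph : ℕ → Set
Digraph n = Fin n → Fin n → Bool

module _ {n : ℕ} (D : Digraph n) where

  Arc : Fin n → Fin n → Set
  Arc i j = T (D i j)

  Oriented : Set
  Oriented = (∀ i → ¬ Arc i i) × (∀ i j → Arc i j → ¬ Arc j i)

  data Walk : Fin n → Fin n → Set where
    [] : ∀ {x} → Walk x x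
    _∷_ : ∀ {x y z} → Arc x y → Walk y z → Walk x z

  verts : ∀ {x y} → Walk x y → List (Fin n)
  verts {x} [] = x ∷ []
  verts {x} (_ ∷ w) = x ∷ verts w

  len : ∀ {x y} → Walk x y → ℕ
  len [] = zero
  len (_ ∷ w) = suc (len w)

  IsPath : ∀ {x y} → Walk x y → Set
  IsPath w = Unique (verts w)

  Contains : ∀ {x y} → Walk x y → Fin n → Set
  Contains w v = v ∈ verts w

  Internal : ∀ {x y} → Walk x y → Fin n → Set
  Internal {x} {y} w v = v ∈ verts w × v ≢ x × v ≢ y

  StronglyConnected : Set
  StronglyConnected = ∀ x y → Σ (Walk x y) IsPath

  -- strong connectivity at least 2: at least 3 vertices, D strong,
  -- and D − w strong for every vertex w
  TwoConnected : Set
  TwoConnected =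
    (3 ≤ n) × StronglyConnected ×
    (∀ w x y → x ≢ w → y ≢ w →
       Σ (Walk x y) λ P → IsPath P × ¬ Contains P w)

  StrongDiam2 : Set
  StrongDiam2 = ∀ i j → i ≢ j → Σ (Walk i j) λ P → IsPath P × len P ≤ 2

  AllDistinct6 : Fin n → Fin n → Fin n → Fin n → Fin n → Fin n → Set
  AllDistinct6 p q a b c r =
    p ≢ q × p ≢ a × p ≢ b × p ≢ c × p ≢ r ×
    q ≢ a × q ≢ b × q ≢ c × q ≢ r ×
    a ≢ b × a ≢ c × a ≢ r ×
    b ≢ c × b ≢ r ×
    c ≢ r

  FConfig : Fin n → Fin n → Fin n → Fin n → Fin n → Fin n → Set
  FConfig p q a b c r =
    AllDistinct6 p q a b c r ×
    Arc p c × Arc q c × Arc q b × Arc b r × Arc a r × Arc p a ×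
    ((P : Walk p r) → IsPath P → Contains P a ⊎ (Contains P c × Contains P b)) ×
    ((P : Walk q r) → IsPath P → Contains P b ⊎ (Contains P c × Contains P a)) ×
    ((P : Walk c r) → IsPath P → Contains P a ⊎ Contains P b)

  InF : Fin n → Fin n → Fin n → Fin n → Fin n → Fin n → Set
  InF p q a b c r =
    Oriented × TwoConnected × StrongDiam2 × FConfig p q a b c r

  InH : Fin n → Fin n → Fin n → Fin n → Set
  InH a b r v =
    (Σ (Walk a r) λ P → IsPath P × ¬ Contains P b × Internal P v) ⊎
    (Σ (Walk b r) λ P → IsPath P × ¬ Contains P a × Internal P v)

module Submission where

open import Defs
open import Data.Nat using (ℕ; _≤_; s≤s)
open import Data.Fin using (Fin; _≟_)
open import Data.Product using (_×_; _,_; Σ; proj₂)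
open import Data.Sum using (_⊎_; inj₁; inj₂; [_,_]; map₂; swap)
open import Data.Empty using (⊥-elim)
open import Data.List.Relation.Unary.Any using (here; there)
open import Data.List.Relation.Unary.All.Properties using (¬Any⇒All¬; All¬⇒¬Any)
open import Data.List.Relation.Unary.AllPairs using (_∷_)
open import Data.List.Relation.Binary.Subset.Propositional using (_⊆_)
open import Data.List.Membership.Propositional using (_∈_)
import Data.List.Membership.DecPropositional as DecMembership
open import Relation.Nullary using (¬_; yes; no; _⊎-dec_)
open import Relation.Unary using (Decidable)
open import Relation.Binary.PropositionalEquality using (_≡_; refl; _≢_; ≢-sym)

-- The only properties of D used are strong diameter 2 and the three path conditions:
-- a vertex of H_ab reaches r avoiding a and b, while p, q and c cannot.
-- A shortest route from p to such a vertex v must pass through a or b just before v;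
-- if it passed through b, then p → b → v followed by the a,b-avoiding route from v
-- would be a path from p to r missing both a and c.

module _ {n : ℕ} (D : Digraph n) where

  open DecMembership (_≟_ {n}) using (_∈?_)

  suffix : ∀ {x y z} (S : Walk D x z) → IsPath D S → y ∈ verts D S →
           Σ (Walk D y z) λ T → IsPath D T × verts D T ⊆ verts D S
  suffix []      uS       (here refl) = [] , uS , λ m → m
  suffix (e ∷ S) uS       (here refl) = e ∷ S , uS , λ m → m
  suffix (_ ∷ S) (_ ∷ uS) (there m) with suffix S uS m
  ... | T , uT , T⊆S = T , uT , λ k → there (T⊆S k)

  suffix-avoiding-start : ∀ {x y z} (S : Walk D x z) → IsPath D S →
    y ∈ verts D S → y ≢ x →
    Σ (Walk D y z) λ T → IsPath D T × ¬ Contains D T x × verts D T ⊆ verts D S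
  suffix-avoiding-start []      _           (here refl) y≢x = ⊥-elim (y≢x refl)
  suffix-avoiding-start (_ ∷ _) _           (here refl) y≢x = ⊥-elim (y≢x refl)
  suffix-avoiding-start (_ ∷ S) (x∉S ∷ uS) (there m)   _   with suffix S uS m
  ... | T , uT , T⊆S = T , uT , (λ k → All¬⇒¬Any x∉S (T⊆S k)) , λ k → there (T⊆S k)

  module Avoiding (r : Fin n) (Blocked : Fin n → Set) where

    Avoids : ∀ {x y} → Walk D x y → Set
    Avoids S = ∀ {u} → Contains D S u → ¬ Blocked u

    Escapes : Fin n → Set
    Escapes x = Σ (Walk D x r) λ S → IsPath D S × Avoids S

    blocked⇒¬escapes : ∀ {x} → Blocked x → ¬ Escapes x
    blocked⇒¬escapes {x} bx (S , _ , avoids) = avoids (start S) bx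
      where
      start : ∀ {y} (W : Walk D x y) → Contains D W x
      start []      = here refl
      start (_ ∷ _) = here refl

    escapes-along : ∀ {x y} (S : Walk D x r) → IsPath D S → Avoids S →
                    y ∈ verts D S → Escapes y
    escapes-along S uS avoids m with suffix S uS m
    ... | T , uT , T⊆S = T , uT , λ k → avoids (T⊆S k)

    ¬escapes⇒∉ : ∀ {x y} (S : Walk D x r) → IsPath D S → Avoids S →
                  ¬ Escapes y → ¬ Contains D S y
    ¬escapes⇒∉ S uS avoids ¬esc m = ¬esc (escapes-along S uS avoids m)

    escapes-backward : ∀ {x y} → ¬ Blocked x → Arc D x y → Escapes y → Escapes x
    escapes-backward {x} ¬bx e (S , uS , avoids) with x ∈? verts D S
    ... | yes m   = escapes-along S uS avoids m
    ... | no  x∉S = (e ∷ S) , (¬Any⇒All¬ _ x∉S ∷ uS) , avoids′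
      where
      avoids′ : Avoids (e ∷ S)
      avoids′ (here refl) = ¬bx
      avoids′ (there m)   = avoids m

    enters-through-blocked : Decidable Blocked → StrongDiam2 D → ∀ {x y} →
      ¬ Escapes x → ¬ Blocked x → Escapes y →
      Σ (Fin n) λ w → Blocked w × Arc D x w × Arc D w y
    enters-through-blocked blocked? diam {x} {y} ¬escx ¬bx escy
      with diam x y (λ { refl → ¬escx escy })
    ... | P , _ , short = through P short
      where
      through : (P : Walk D x y) → len D P ≤ 2 →
                Σ (Fin n) λ w → Blocked w × Arc D x w × Arc D w y
      through [] _ = ⊥-elim (¬escx escy)
      through (e ∷ []) _ = ⊥-elim (¬escx (escapes-backward ¬bx e escy))
      through (_∷_ {y = w} e₁ (e₂ ∷ [])) _ with blocked? w
      ... | yes bw  = w , bw , e₁ , e₂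
      ... | no  ¬bw = ⊥-elim (¬escx (escapes-backward ¬bx e₁ (escapes-backward ¬bw e₂ escy)))
      through (_ ∷ _ ∷ _ ∷ _) (s≤s (s≤s ()))

    no-detour : ∀ {x w y} → Arc D x w → Arc D w y → x ≢ w →
      ¬ Escapes x → ¬ Escapes w → Escapes y →
      ¬ ((P : Walk D x r) → IsPath D P →
           Σ (Fin n) λ z → ¬ Escapes z × z ≢ x × z ≢ w × Contains D P z)
    no-detour e₁ e₂ x≢w ¬escx ¬escw (S , uS , avoids) meets
      with meets (e₁ ∷ e₂ ∷ S) uP
      where
      uP : IsPath D (e₁ ∷ e₂ ∷ S)
      uP = ¬Any⇒All¬ _ (λ { (here refl) → x≢w refl
                           ; (there m)   → ¬escapes⇒∉ S uS avoids ¬escx m })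
         ∷ ¬Any⇒All¬ _ (¬escapes⇒∉ S uS avoids ¬escw)
         ∷ uS
    ... | _ , _    , z≢x , _   , here refl         = z≢x refl
    ... | _ , _    , _   , z≢w , there (here refl) = z≢w refl
    ... | _ , ¬esc , _   , _   , there (there m)   = ¬escapes⇒∉ S uS avoids ¬esc m

IsOneOf : ∀ {n} → Fin n → Fin n → Fin n → Set
IsOneOf a b z = z ≡ a ⊎ z ≡ b

module _ {n : ℕ} (D : Digraph n) (a b r : Fin n) where

  open Avoiding D r (IsOneOf a b)

  InH⇒escapes : ∀ {v} → InH D a b r v → Escapes v
  InH⇒escapes (inj₁ (P , uP , b∉P , v∈P , v≢a , _))
    with suffix-avoiding-start D P uP v∈P v≢a
  ... | T , uT , a∉T , T⊆P = T , uT , λ { k (inj₁ refl) → a∉T k ; k (inj₂ refl) → b∉P (T⊆P k) }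
  InH⇒escapes (inj₂ (P , uP , a∉P , v∈P , v≢b , _))
    with suffix-avoiding-start D P uP v∈P v≢b
  ... | T , uT , b∉T , T⊆P = T , uT , λ { k (inj₁ refl) → a∉P (T⊆P k) ; k (inj₂ refl) → b∉T k }

  ¬escapes-from : ∀ {x} → ((P : Walk D x r) → IsPath D P → Contains D P a ⊎ Contains D P b) →
                  ¬ Escapes x
  ¬escapes-from every (P , uP , avoids) =
    [ (λ k → avoids k (inj₁ refl)) , (λ k → avoids k (inj₂ refl)) ] (every P uP)

  oneOf? : Decidable (IsOneOf a b)
  oneOf? w = (w ≟ a) ⊎-dec (w ≟ b)

  arc-into-H : StrongDiam2 D → ∀ {x c v} → InH D a b r v →
    x ≢ a → x ≢ b → x ≢ c → a ≢ b → b ≢ c →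
    ((P : Walk D x r) → IsPath D P → Contains D P a ⊎ (Contains D P c × Contains D P b)) →
    ((P : Walk D c r) → IsPath D P → Contains D P a ⊎ Contains D P b) →
    Arc D a v
  arc-into-H diam {x} {c} {v} v∈H x≢a x≢b x≢c a≢b b≢c condX condC =
    from-gate (enters-through-blocked oneOf? diam ¬escX [ x≢a , x≢b ] escV)
    where
    escV : Escapes v
    escV = InH⇒escapes v∈H
    ¬escX : ¬ Escapes x
    ¬escX = ¬escapes-from λ P uP → map₂ proj₂ (condX P uP)
    from-gate : Σ (Fin n) (λ w → IsOneOf a b w × Arc D x w × Arc D w v) → Arc D a v
    from-gate (_ , inj₁ refl , _   , a→v) = a→v
    from-gate (_ , inj₂ refl , x→b , b→v) =
      ⊥-elim (no-detour x→b b→v x≢b ¬escX (blocked⇒¬escapes (inj₂ refl)) escV λ P uP →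
        [ (λ a∈P → a , blocked⇒¬escapes (inj₁ refl) , ≢-sym x≢a , a≢b , a∈P)
        , (λ (c∈P , _) → c , ¬escapes-from condC , ≢-sym x≢c , ≢-sym b≢c , c∈P) ] (condX P uP))

proposition8 : (n : ℕ) (D : Digraph n) (p q a b c r : Fin n) →
    InF D p q a b c r →
    (v : Fin n) → InH D a b r v →
    Arc D a v × Arc D b v
proposition8 n D p q a b c r
  (_ , _ , diam , (_ , p≢a , p≢b , p≢c , _ , q≢a , q≢b , q≢c , _ , a≢b , a≢c , _ , b≢c , _ , _) ,
   _ , _ , _ , _ , _ , _ , condP , condQ , condC) v v∈H =
  arc-into-H D a b r diam v∈H p≢a p≢b p≢c a≢b b≢c condP condC ,
  arc-into-H D b a r diam (swap v∈H) q≢b q≢a q≢c (≢-sym a≢b) a≢c condQ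
    (λ P uP → swap (condC P uP))
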